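{- Let $n, m, d$ be positive integers with $m<n$, and let $A$ be any $(n,m,d)$-array. Then $P(n,d) \ge \sum_{\tau \in A} P_\tau(n,d)$.
   Context: For permutations $\sigma,\pi$ of $[1\ldots n]=\{1,\dots,n\}$ (written as strings), the Kendall-$\tau$ distance $d(\sigma,\pi)$ is the minimum number of adjacent transpositions needed to transform $\sigma$ into $\pi$. An $(n,d)$-PA is a set of permutations of $[1\ldots n]$ whose pairwise Kendall-$\tau$ distances are all at least $d$, and $P(n,d)$ is the maximum cardinality of an $(n,d)$-PA. For $m<n$, $S_{n,m}$ is the set of permutations of $[1\ldots n]$ in which the symbols $1,\dots,n-m$ appear in increasing order; an $(n,m,d)$-array is a subset of $S_{n,m}$ with pairwise Kendall-$\tau$ distances all at least $d$. For $\tau\in S_{n,m}$, $P_\tau(n,d)$ denotes the maximum cardinality of an $(n,d)$-PA all of whose permutations have each of the $m$ largest symbols $n-m+1,\dots,n$ in the same position as in $\tau$ (the remaining $n-m$ symbols may be in any order in the other positions). -}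

module Defs where

open import Data.Nat using (ℕ; zero; suc; _<_; _∸_; _≥_; _≤_)
open import Data.Fin using (Fin; toℕ)
open import Data.Vec using (Vec; lookup; _[_]≔_; toList)
open import Data.List using (List; length)
open import Data.List.Membership.Propositional using (_∈_)
open import Data.List.Relation.Unary.All using (All)
open import Data.List.Relation.Unary.AllPairs using (AllPairs)
open import Data.List.Relation.Unary.Unique.Propositional using (Unique)
open import Data.Product using (Σ; _×_; ∃)
open import Relation.Binary.PropositionalEquality using (_≡_)
open import Relation.Nullary using (¬_)

-- A string of length n over the alphabet Fin n; symbol k : Fin n stands for k+1.
-- Position i (0-based) holds symbol  lookup σ i.
Word : ℕ → Set
Word n = Vec (Fin n) n

IsPerm : ∀ {n} → Word n → Set
IsPerm {n} σ = (∀ (s : Fin n) → s ∈ toList σ) × Unique (toList σ)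

AdjStep : ∀ {n} → Word n → Word n → Set
AdjStep {n} σ π =
  Σ (Fin n) λ i → Σ (Fin n) λ j → (toℕ j ≡ suc (toℕ i)) ×
    (π ≡ ((σ [ i ]≔ lookup σ j) [ j ]≔ lookup σ i))

data ReachIn {n} : ℕ → Word n → Word n → Set where
  here : ∀ {σ} → ReachIn zero σ σ
  step : ∀ {k σ τ π} → AdjStep σ τ → ReachIn k τ π → ReachIn (suc k) σ π

KDistAtLeast : ∀ {n} → ℕ → Word n → Word n → Set
KDistAtLeast d σ π = ∀ k → k < d → ¬ ReachIn k σ π

IsPA : (n d : ℕ) → List (Word n) → Set
IsPA n d C = All IsPerm C × Unique C × AllPairs (KDistAtLeast d) C

IsPmax : (n d k : ℕ) → Set
IsPmax n d k =
  (Σ (List (Word n)) λ C → IsPA n d C × length C ≡ k)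
  × (∀ C → IsPA n d C → length C ≤ k)

-- symbol s is one of the m largest symbols n-m+1,...,n
Large : ∀ {n} → ℕ → Fin n → Set
Large {n} m s = toℕ s ≥ n ∸ m

InS : ∀ {n} → ℕ → Word n → Set
InS {n} m σ = IsPerm σ ×
  (∀ (i j : Fin n) → toℕ i < toℕ j →
     ¬ Large m (lookup σ i) → ¬ Large m (lookup σ j) →
     toℕ (lookup σ i) < toℕ (lookup σ j))

IsArray : (n m d : ℕ) → List (Word n) → Set
IsArray n m d A = All (InS m) A × Unique A × AllPairs (KDistAtLeast d) A

Agrees : ∀ {n} → ℕ → Word n → Word n → Set
Agrees {n} m τ σ = ∀ (i : Fin n) → Large m (lookup τ i) → lookup σ i ≡ lookup τ i

-- P_τ(n,d) = k   (the parameter m is implicit in the paper; explicit here)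
IsPτmax : (n m d : ℕ) → Word n → ℕ → Set
IsPτmax n m d τ k =
  (Σ (List (Word n)) λ C → IsPA n d C × All (Agrees m τ) C × length C ≡ k)
  × (∀ C → IsPA n d C → All (Agrees m τ) C → length C ≤ k)

-- Kendall-τ distance cannot increase when a path is projected onto S_{n,m}:
-- follow the path from σ to π, ignoring every adjacent swap of two small
-- symbols and performing every other swap.  The projected word keeps the
-- large symbols where the path has them and the small ones in increasing
-- order, so it starts at τ (agreeing with σ) and ends at τ′ (agreeing with
-- π).  Hence words agreeing with distinct members of an (n,m,d)-array are
-- at distance ≥ d, and optimal codes for the members of the array can be
-- united into one (n,d)-PA.
module Submission where

open import Defs
open import Data.Nat using (ℕ; suc; _<_; _≤_; _≥_; _≮_; _+_; _∸_; z≤n; s≤s)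
open import Data.Nat.Properties
  using (<-cmp; <-irrefl; <-asym; <-trans; ≤-trans; ≤-<-trans; ≤-pred; n<1+n; m≤n⇒m≤1+n; ≤∧≢⇒<; _≤?_)
open import Data.Fin using (Fin; toℕ; zero; suc)
open import Data.Fin.Properties using (toℕ-injective; toℕ<n; _≟_)
open import Data.Fin.Permutation.Components using (transpose; transpose-inverse)
open import Data.Vec using (Vec; _∷_; lookup; _[_]≔_; toList)
open import Data.Vec.Properties using (lookup∘update; lookup∘update′; tabulate∘lookup; tabulate-cong)
import Data.Vec.Relation.Unary.All.Properties as VecAllP
open import Data.Vec.Relation.Unary.Any using (index)
open import Data.Vec.Relation.Unary.Any.Properties using (lookup-index)
open import Data.Vec.Membership.Propositional.Properties using (∈-toList⁻)
open import Data.List using (List; []; _∷_; _++_; length; map)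
open import Data.List.Properties using (length-++)
open import Data.Nat.ListAction using (sum)
open import Data.List.Membership.Propositional using (_∈_)
open import Data.List.Relation.Unary.Any using (here; there)
open import Data.List.Relation.Unary.All as All using (All; []; _∷_)
open import Data.List.Relation.Unary.All.Properties using (++⁺)
import Data.List.Relation.Unary.AllPairs as AllPairs
open import Data.List.Relation.Unary.AllPairs using (AllPairs; []; _∷_)
import Data.List.Relation.Unary.AllPairs.Properties as AllPairsP
open import Data.List.Relation.Unary.Unique.Propositional using (Unique)
open import Data.Product using (Σ; ∃; _×_; _,_; proj₁; proj₂)
open import Data.Sum using (_⊎_; inj₁; inj₂; [_,_])
open import Data.Empty using (⊥-elim)
open import Function using (_∘_)
open import Relation.Nullary using (¬_; Dec; yes; no; _⊎-dec_)
open import Relation.Binary using (tri<; tri≈; tri>)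
open import Relation.Binary.PropositionalEquality hiding ([_])

-- transpose i j k unfolds to a stuck with-application, so callers generalise
-- over it together with the view: with transpose i j k | transpose-view i j k.
data TransposeView {n} (i j k : Fin n) : Fin n → Set where
  at-i  : k ≡ i → TransposeView i j k j
  at-j  : k ≢ i → k ≡ j → TransposeView i j k i
  other : k ≢ i → k ≢ j → TransposeView i j k k

transpose-view : ∀ {n} (i j k : Fin n) → TransposeView i j k (transpose i j k)
transpose-view i j k with k ≟ i
... | yes k≡i = at-i k≡i
... | no k≢i with k ≟ j
...   | yes k≡j = at-j k≢i k≡j
...   | no k≢j = other k≢i k≢j

transpose-first : ∀ {n} (i j : Fin n) → transpose i j i ≡ j
transpose-first i j with i ≟ i
... | yes _ = refl
... | no i≢i = ⊥-elim (i≢i refl)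

transpose-second : ∀ {n} {i j : Fin n} → i ≢ j → transpose i j j ≡ i
transpose-second {i = i} {j} i≢j with j ≟ i
... | yes j≡i = ⊥-elim (i≢j (sym j≡i))
... | no _ with j ≟ j
...   | yes _ = refl
...   | no j≢j = ⊥-elim (j≢j refl)

transpose-adjacent-monotone : ∀ {n} {i j a b : Fin n} → toℕ j ≡ suc (toℕ i) →
  toℕ a < toℕ b → ¬ (a ≡ i × b ≡ j) → toℕ (transpose i j a) < toℕ (transpose i j b)
transpose-adjacent-monotone {i = i} {j} {a} {b} adj a<b not-ij
  with transpose i j a | transpose-view i j a | transpose i j b | transpose-view i j b
... | _ | at-i refl   | _ | at-i refl   = ⊥-elim (<-irrefl refl a<b)
... | _ | at-i refl   | _ | at-j _ refl = ⊥-elim (not-ij (refl , refl))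
... | _ | at-i refl   | _ | other _ b≢j =
  subst (_< toℕ b) (sym adj) (≤∧≢⇒< a<b (λ e → b≢j (toℕ-injective (trans (sym e) (sym adj)))))
... | _ | at-j _ refl | _ | at-i refl   = ⊥-elim (<-asym a<b i<j)
  where i<j = subst (toℕ i <_) (sym adj) (n<1+n (toℕ i))
... | _ | at-j _ refl | _ | at-j _ refl = ⊥-elim (<-irrefl refl a<b)
... | _ | at-j _ refl | _ | other _ _   = <-trans (subst (toℕ i <_) (sym adj) (n<1+n (toℕ i))) a<b
... | _ | other _ _   | _ | at-i refl   = <-trans a<b (subst (toℕ b <_) (sym adj) (n<1+n (toℕ b)))
... | _ | other a≢i _ | _ | at-j _ refl =
  ≤∧≢⇒< (≤-pred (subst (toℕ a <_) adj a<b)) (a≢i ∘ toℕ-injective)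
... | _ | other _ _   | _ | other _ _   = a<b

-- AdjStep σ π is π ≡ swap σ i j with toℕ j ≡ suc (toℕ i), definitionally.
swap : ∀ {A : Set} {n} → Vec A n → Fin n → Fin n → Vec A n
swap v i j = (v [ i ]≔ lookup v j) [ j ]≔ lookup v i

lookup-swap : ∀ {A : Set} {n} (v : Vec A n) (i j k : Fin n) →
  lookup (swap v i j) k ≡ lookup v (transpose i j k)
lookup-swap v i j k with transpose i j k | transpose-view i j k
... | _ | at-i refl with k ≟ j
...   | yes refl = lookup∘update k (v [ k ]≔ lookup v k) (lookup v k)
...   | no k≢j = trans (lookup∘update′ k≢j (v [ k ]≔ lookup v j) (lookup v k)) (lookup∘update k v (lookup v j))
lookup-swap v i j k | _ | at-j _ refl = lookup∘update k (v [ i ]≔ lookup v k) (lookup v i)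
lookup-swap v i j k | _ | other k≢i k≢j =
  trans (lookup∘update′ k≢j (v [ i ]≔ lookup v j) (lookup v i)) (lookup∘update′ k≢i v (lookup v j))

lookup-extensional : ∀ {A : Set} {n} {v w : Vec A n} → (∀ k → lookup v k ≡ lookup w k) → v ≡ w
lookup-extensional {v = v} {w} eq =
  trans (sym (tabulate∘lookup v)) (trans (tabulate-cong eq) (tabulate∘lookup w))

lookup-injective : ∀ {A : Set} {n} {v : Vec A n} → Unique (toList v) →
  ∀ {i j} → lookup v i ≡ lookup v j → i ≡ j
lookup-injective {v = x ∷ v} (x∉v ∷ v-unique) {zero}  {zero}  _ = refl
lookup-injective {v = x ∷ v} (x∉v ∷ v-unique) {zero}  {suc j} e =
  ⊥-elim (VecAllP.lookup⁺ (VecAllP.toList⁻ x∉v) j e)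
lookup-injective {v = x ∷ v} (x∉v ∷ v-unique) {suc i} {zero}  e =
  ⊥-elim (VecAllP.lookup⁺ (VecAllP.toList⁻ x∉v) i (sym e))
lookup-injective {v = x ∷ v} (x∉v ∷ v-unique) {suc i} {suc j} e = cong suc (lookup-injective v-unique e)

Onto : ∀ {A : Set} {n} → Vec A n → Set
Onto {A} v = ∀ (x : A) → ∃ λ k → lookup v k ≡ x

perm-onto : ∀ {n} {σ : Word n} → IsPerm σ → Onto σ
perm-onto (all-occur , _) s = let s∈σ = ∈-toList⁻ (all-occur s) in index s∈σ , sym (lookup-index s∈σ)

swap-onto : ∀ {A : Set} {n} {v : Vec A n} (i j : Fin n) → Onto v → Onto (swap v i j)
swap-onto {v = v} i j onto x with onto x
... | k , vk≡x = transpose j i k , trans (lookup-swap v i j _) (trans (cong (lookup v) (transpose-inverse i j)) vk≡x)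

module _ {n : ℕ} (m : ℕ) where

  large? : (s : Fin n) → Dec (Large m s)
  large? s = n ∸ m ≤? toℕ s

  SmallsInOrder : Word n → Set
  SmallsInOrder σ = ∀ (i j : Fin n) → toℕ i < toℕ j →
    ¬ Large m (lookup σ i) → ¬ Large m (lookup σ j) → toℕ (lookup σ i) < toℕ (lookup σ j)

  -- Weakens InS m (Onto in place of IsPerm) to an invariant that swaps preserve.
  Standard : Word n → Set
  Standard σ = SmallsInOrder σ × Onto σ

  SameLarge : Word n → Word n → Set
  SameLarge σ π = Agrees m σ π × Agrees m π σ

  agrees-trans : ∀ {σ τ π : Word n} → Agrees m σ τ → Agrees m τ π → Agrees m σ π
  agrees-trans στ τπ k l = trans (τπ k (subst (Large m) (sym (στ k l)) l)) (στ k l)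

  agrees-small : ∀ {σ π : Word n} → Agrees m σ π → ∀ {k} → ¬ Large m (lookup π k) → ¬ Large m (lookup σ k)
  agrees-small σπ {k} small l = small (subst (Large m) (sym (σπ k l)) l)

  sameLarge-trans : ∀ {σ τ π : Word n} → SameLarge σ τ → SameLarge τ π → SameLarge σ π
  sameLarge-trans {σ} {τ} {π} (στ , τσ) (τπ , πτ) = agrees-trans {σ} {τ} {π} στ τπ , agrees-trans {π} {τ} {σ} πτ τσ

  perm-agrees-sym : ∀ {τ σ : Word n} → IsPerm τ → IsPerm σ → Agrees m τ σ → Agrees m σ τ
  perm-agrees-sym {τ} {σ} τ-perm σ-perm τσ k l with perm-onto τ-perm (lookup σ k)
  ... | a , τa≡σk with lookup-injective (proj₂ σ-perm) (trans (τσ a (subst (Large m) (sym τa≡σk) l)) τa≡σk)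
  ...   | refl = τa≡σk

  agrees-swap : ∀ {σ π : Word n} (i j : Fin n) → Agrees m σ π → Agrees m (swap σ i j) (swap π i j)
  agrees-swap {σ} {π} i j σπ k l =
    trans (lookup-swap π i j k) (trans (σπ _ (subst (Large m) (lookup-swap σ i j k) l)) (sym (lookup-swap σ i j k)))

  sameLarge-swap : ∀ {σ π : Word n} (i j : Fin n) → SameLarge σ π → SameLarge (swap σ i j) (swap π i j)
  sameLarge-swap {σ} {π} i j (σπ , πσ) = agrees-swap {σ} {π} i j σπ , agrees-swap {π} {σ} i j πσ

  swap-small-fixes-large : ∀ {σ : Word n} {i j k : Fin n} → ¬ Large m (lookup σ i) → ¬ Large m (lookup σ j) →
    Large m (lookup σ k) ⊎ Large m (lookup σ (transpose i j k)) → transpose i j k ≡ k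
  swap-small-fixes-large {σ} {i} {j} {k} small-i small-j large with transpose i j k | transpose-view i j k
  ... | _ | at-i refl   = ⊥-elim ([ small-i , small-j ] large)
  ... | _ | at-j _ refl = ⊥-elim ([ small-j , small-i ] large)
  ... | _ | other _ _   = refl

  swap-small-sameLarge : ∀ {σ : Word n} {i j : Fin n} → ¬ Large m (lookup σ i) → ¬ Large m (lookup σ j) →
    SameLarge σ (swap σ i j)
  swap-small-sameLarge {σ} {i} {j} small-i small-j =
      (λ k l → trans (lookup-swap σ i j k) (cong (lookup σ) (fixes (inj₁ l))))
    , (λ k l → sym (trans (lookup-swap σ i j k)
                 (cong (lookup σ) (fixes (inj₂ (subst (Large m) (lookup-swap σ i j k) l))))))
    where
    fixes : ∀ {k} → Large m (lookup σ k) ⊎ Large m (lookup σ (transpose i j k)) → transpose i j k ≡ k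
    fixes = swap-small-fixes-large {σ} small-i small-j

  swap-smallsInOrder : ∀ {σ : Word n} {i j : Fin n} → toℕ j ≡ suc (toℕ i) →
    Large m (lookup σ i) ⊎ Large m (lookup σ j) → SmallsInOrder σ → SmallsInOrder (swap σ i j)
  swap-smallsInOrder {σ} {i} {j} adj large ordered a b a<b small-a small-b =
    subst₂ (λ x y → toℕ x < toℕ y) (sym (lookup-swap σ i j a)) (sym (lookup-swap σ i j b))
      (ordered _ _ (transpose-adjacent-monotone adj a<b not-ij) small-a′ small-b′)
    where
    small-a′ : ¬ Large m (lookup σ (transpose i j a))
    small-a′ = small-a ∘ subst (Large m) (sym (lookup-swap σ i j a))
    small-b′ : ¬ Large m (lookup σ (transpose i j b))
    small-b′ = small-b ∘ subst (Large m) (sym (lookup-swap σ i j b))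
    i≢j : i ≢ j
    i≢j i≡j = <-irrefl (cong toℕ i≡j) (subst (toℕ i <_) (sym adj) (n<1+n (toℕ i)))
    not-ij : ¬ (a ≡ i × b ≡ j)
    not-ij (refl , refl) =
      [ small-b′ ∘ subst (Large m ∘ lookup σ) (sym (transpose-second i≢j))
      , small-a′ ∘ subst (Large m ∘ lookup σ) (sym (transpose-first i j)) ] large

  -- At the first position k where two standard words with the same large
  -- entries differ, both entries are small; the symbol of w at k must then
  -- occur in v after k, which the ordering of small symbols forbids.
  first-difference-not-smaller : ∀ {w v : Word n} {k} → SmallsInOrder w → Standard v → Agrees m v w →
    (∀ a → toℕ a < toℕ k → lookup w a ≡ lookup v a) → ¬ Large m (lookup w k) →
    toℕ (lookup w k) ≮ toℕ (lookup v k)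
  first-difference-not-smaller {w} {v} {k} w-ordered (v-ordered , v-onto) vw agree-below small wk<vk
    with v-onto (lookup w k)
  ... | a , va≡wk with <-cmp (toℕ a) (toℕ k)
  ... | tri< a<k _ _ = <-irrefl (cong toℕ wa≡wk)
    (w-ordered a k a<k (small ∘ subst (Large m) wa≡wk) small)
    where wa≡wk = trans (agree-below a a<k) va≡wk
  ... | tri≈ _ a≡k _ rewrite toℕ-injective a≡k = <-irrefl (cong toℕ (sym va≡wk)) wk<vk
  ... | tri> _ _ k<a = <-asym wk<vk
    (subst (λ x → toℕ (lookup v k) < toℕ x) va≡wk
      (v-ordered k a k<a (agrees-small {v} {w} vw small) (small ∘ subst (Large m) va≡wk)))

  standard-unique : ∀ {w v : Word n} → Standard w → Standard v → SameLarge w v → w ≡ v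
  standard-unique {w} {v} w-std v-std (wv , vw) = lookup-extensional (λ k → agree-below n k (toℕ<n k))
    where
    agree-below : ∀ N k → toℕ k < N → lookup w k ≡ lookup v k
    agree-below (suc N) k (s≤s k≤N) with large? (lookup w k) | large? (lookup v k)
    ... | yes l | _ = sym (wv k l)
    ... | no _ | yes l = vw k l
    ... | no small-w | no small-v with <-cmp (toℕ (lookup w k)) (toℕ (lookup v k))
    ...   | tri< wk<vk _ _ = ⊥-elim (first-difference-not-smaller {w} {v} (proj₁ w-std) v-std vw
                                       (λ a a<k → agree-below N a (≤-trans a<k k≤N)) small-w wk<vk)
    ...   | tri≈ _ wk≡vk _ = toℕ-injective wk≡vk
    ...   | tri> _ _ vk<wk = ⊥-elim (first-difference-not-smaller {v} {w} (proj₁ v-std) w-std wv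
                                       (λ a a<k → sym (agree-below N a (≤-trans a<k k≤N))) small-v vk<wk)

  project-step : ∀ {u u′ w : Word n} → AdjStep u u′ → SameLarge w u → Standard w →
    SameLarge w u′ ⊎ Σ (Word n) λ w′ → AdjStep w w′ × SameLarge w′ u′ × Standard w′
  project-step {u} {w = w} (i , j , adj , refl) (wu , uw) (w-ordered , w-onto)
    with large? (lookup w i) ⊎-dec large? (lookup w j)
  ... | yes large = inj₂ (swap w i j , (i , j , adj , refl)
                         , sameLarge-swap {w} {u} i j (wu , uw)
                         , swap-smallsInOrder {w} adj large w-ordered , swap-onto {v = w} i j w-onto)
  ... | no ¬large = inj₁ (sameLarge-trans {w} {u} {swap u i j} (wu , uw)
                           (swap-small-sameLarge {u} (agrees-small {u} {w} uw (¬large ∘ inj₁))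
                                                     (agrees-small {u} {w} uw (¬large ∘ inj₂))))

  project : ∀ {k} {u π w : Word n} → ReachIn k u π → SameLarge w u → Standard w →
    ∃ λ k′ → k′ ≤ k × ∃ λ w′ → ReachIn k′ w w′ × SameLarge w′ π × Standard w′
  project here w≈u w-std = 0 , z≤n , _ , here , w≈u , w-std
  project (step u→u′ path) w≈u w-std with project-step u→u′ w≈u w-std
  ... | inj₁ w≈u′ = let k′ , k′≤k , rest = project path w≈u′ w-std in k′ , m≤n⇒m≤1+n k′≤k , rest
  ... | inj₂ (w′ , w→w′ , w′≈u′ , w′-std) =
    let k′ , k′≤k , w″ , path′ , rest = project path w′≈u′ w′-std
    in suc k′ , s≤s k′≤k , w″ , step w→w′ path′ , rest

  agreeing-distance : ∀ {d} {τ τ′ σ π : Word n} → InS m τ → InS m τ′ → KDistAtLeast d τ τ′ →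
    IsPerm σ → Agrees m τ σ → IsPerm π → Agrees m τ′ π → KDistAtLeast d σ π
  agreeing-distance {τ = τ} {τ′} {σ} {π} (τ-perm , τ-ordered) (τ′-perm , τ′-ordered) τ-far-τ′
                    σ-perm τσ π-perm τ′π k k<d σ→π
    with project σ→π (τσ , perm-agrees-sym τ-perm σ-perm τσ) (τ-ordered , perm-onto τ-perm)
  ... | k′ , k′≤k , w , τ→w , w≈π , w-std =
    τ-far-τ′ k′ (≤-<-trans k′≤k k<d) (subst (ReachIn k′ τ) w≡τ′ τ→w)
    where
    w≡τ′ : w ≡ τ′
    w≡τ′ = standard-unique w-std (τ′-ordered , perm-onto τ′-perm)
             (sameLarge-trans {w} {π} {τ′} w≈π (perm-agrees-sym τ′-perm π-perm τ′π , τ′π))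

distance-distinct : ∀ {n d} {σ π : Word n} → 0 < d → KDistAtLeast d σ π → σ ≢ π
distance-distinct 0<d far refl = far 0 0<d here

module _ {n : ℕ} (m d : ℕ) where

  AgreesWithSome : List (Word n) → Word n → Set
  AgreesWithSome A σ = ∃ λ τ → τ ∈ A × Agrees m τ σ

  union-of-codes : (pτ : Word n → ℕ) (A : List (Word n)) →
    All (InS m) A → AllPairs (KDistAtLeast d) A → All (λ τ → IsPτmax n m d τ (pτ τ)) A →
    Σ (List (Word n)) λ C → All IsPerm C × AllPairs (KDistAtLeast d) C × All (AgreesWithSome A) C
      × length C ≡ sum (map pτ A)
  union-of-codes pτ [] [] [] [] = [] , [] , [] , [] , refl
  union-of-codes pτ (τ ∷ A) (τ-in-S ∷ A-in-S) (τ-far ∷ A-far)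
                 (((Cτ , (Cτ-perm , _ , Cτ-far) , Cτ-agree , Cτ-length) , _) ∷ A-codes)
    with union-of-codes pτ A A-in-S A-far A-codes
  ... | C , C-perm , C-far , C-agree , C-length =
      Cτ ++ C
    , ++⁺ Cτ-perm C-perm
    , AllPairsP.++⁺ Cτ-far C-far cross
    , ++⁺ (All.map (λ agree → τ , here refl , agree) Cτ-agree)
          (All.map (λ (τ′ , τ′∈A , agree) → τ′ , there τ′∈A , agree) C-agree)
    , trans (length-++ Cτ) (cong₂ _+_ Cτ-length C-length)
    where
    cross : All (λ σ → All (KDistAtLeast d σ) C) Cτ
    cross = All.map (λ (σ-perm , τσ) → All.map (λ (π-perm , τ′ , τ′∈A , τ′π) →
                      agreeing-distance m τ-in-S (All.lookup A-in-S τ′∈A) (All.lookup τ-far τ′∈A)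
                                        σ-perm τσ π-perm τ′π)
                    (All.zip (C-perm , C-agree)))
              (All.zip (Cτ-perm , Cτ-agree))

theorem7 : (n m d : ℕ) → 0 < n → 0 < m → 0 < d → m < n →
    (A : List (Word n)) → IsArray n m d A →
    (p : ℕ) → IsPmax n d p →
    (pτ : Word n → ℕ) → All (λ τ → IsPτmax n m d τ (pτ τ)) A →
    p ≥ sum (map pτ A)
theorem7 n m d _ _ 0<d _ A (A-in-S , _ , A-far) p (_ , p-maximal) pτ A-codes
  with union-of-codes m d pτ A A-in-S A-far A-codes
... | C , C-perm , C-far , _ , C-length =
  subst (_≤ p) C-length (p-maximal C (C-perm , AllPairs.map (distance-distinct 0<d) C-far , C-far))
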